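{- Let $\psi\colon 2^{[n]}\to\mathbb{N}$ be an integral polymatroid rank function with $\psi(A)\le r$ for all $A\subseteq[n]$, where $r$ is a fixed integer. Then the number of vertices of the polymatroid $\mathcal{P}(\psi)$ is bounded by a polynomial in $n$ of degree $r$.
   Context: A polymatroid rank function $\psi$ on $2^{[n]}$ is submodular ($\psi(X\cap Y)+\psi(X\cup Y)\le\psi(X)+\psi(Y)$), non-decreasing, and satisfies $\psi(\emptyset)=0$; it is integral if integer-valued. The polymatroid is $\mathcal{P}(\psi)=\{\mathbf{x}\in\mathbb{R}^n:\sum_{i\in A}x_i\le\psi(A)\ \forall A\subseteq[n],\ \mathbf{x}\ge\mathbf{0}\}$. -}

module Defs where

open import Data.Nat using (ℕ; suc) renaming (_≤_ to _≤ℕ_; _+_ to _+ℕ_)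
open import Data.Bool using (true; false)
open import Data.Fin using (Fin)
open import Data.Fin.Subset using (Subset; _∩_; _∪_; _⊆_; ⊥)
open import Data.Vec using (Vec; []; _∷_; zipWith; replicate)
open import Data.Rational using (ℚ; 0ℚ; _+_; _-_; _≤_; _/_)
open import Data.Integer using (+_)
open import Data.Vec.Relation.Unary.All as VAll using ()
open import Data.Product using (_×_)
open import Relation.Binary.PropositionalEquality using (_≡_)

record IsPolymatroidRank {n : ℕ} (ψ : Subset n → ℕ) : Set where
  field
    submodular : ∀ X Y → ψ (X ∩ Y) +ℕ ψ (X ∪ Y) ≤ℕ ψ X +ℕ ψ Y
    monotone   : ∀ X Y → X ⊆ Y → ψ X ≤ℕ ψ Y
    empty      : ψ ⊥ ≡ 0

sumOver : {n : ℕ} → Subset n → Vec ℚ n → ℚ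
sumOver []          []       = 0ℚ
sumOver (true ∷ A)  (x ∷ xs) = x + sumOver A xs
sumOver (false ∷ A) (x ∷ xs) = sumOver A xs

InPolymatroid : {n : ℕ} → (Subset n → ℕ) → Vec ℚ n → Set
InPolymatroid ψ x =
  (∀ A → sumOver A x ≤ ((+ ψ A) / 1)) × VAll.All (λ xi → 0ℚ ≤ xi) x

IsVertex : {n : ℕ} → (Subset n → ℕ) → Vec ℚ n → Set
IsVertex {n} ψ x =
  InPolymatroid ψ x ×
  (∀ (y : Vec ℚ n) → InPolymatroid ψ (zipWith _+_ x y) →
     InPolymatroid ψ (zipWith _-_ x y) → y ≡ replicate n 0ℚ)

module Submission where

-- The point is that every vertex x of P(ψ) is integral.  Call S tight when
-- x(S) = ψ(S).  By submodularity of ψ and modularity of x(·), tight sets are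
-- closed under ∩ and ∪.  Since x is a vertex, it cannot be moved by a small
-- ±w that vanishes on tight sets and off its support; applying this to
-- w = ε·1ₑ and w = ε·(1ₑ - 1ᵢ) shows that each support element e lies in a
-- tight set and that distinct support elements are separated by tight sets.
-- Hence the least tight set A containing e and the greatest tight set U
-- avoiding e satisfy A = (A ∩ U) + e on the support, so x(e) = ψ(A) - ψ(A ∩ U)
-- is a natural number.  The coordinates then sum to x([n]) ≤ ψ([n]) ≤ r, and
-- the natural vectors of sum ≤ r number at most (n + 1)ʳ.

open import Defs
open import Data.Nat using (ℕ)
open import Data.Fin.Subset using (Subset)
open import Data.Vec using (Vec)
open import Data.Rational using (ℚ)

module NatEmbedding where

  import Data.Nat as ℕ
  open import Data.Integer as ℤ using (+_)
  import Data.Integer.Properties as ℤ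
  open import Data.Rational
  open import Data.Rational.Properties using (normalize-coprime)
  import Data.Nat.Coprimality as Coprime
  open import Relation.Binary.PropositionalEquality

  ι : ℕ → ℚ
  ι k = (+ k) / 1

  ι-normal : ∀ k → ι k ≡ mkℚ (+ k) 0 (Coprime.sym (Coprime.1-coprimeTo k))
  ι-normal k = normalize-coprime (Coprime.sym (Coprime.1-coprimeTo k))

  ι-homo-+ : ∀ a b → ι (a ℕ.+ b) ≡ ι a + ι b
  ι-homo-+ a b rewrite ι-normal a | ι-normal b | ι-normal (a ℕ.+ b) =
    trans (sym (ι-normal (a ℕ.+ b)))
      (cong₂ (λ u v → (u ℤ.+ v) / 1) (sym (ℤ.*-identityʳ (+ a))) (sym (ℤ.*-identityʳ (+ b))))

  ι-mono-≤ : ∀ {a b} → a ℕ.≤ b → ι a ≤ ι b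
  ι-mono-≤ {a} {b} a≤b rewrite ι-normal a | ι-normal b =
    *≤* (subst₂ ℤ._≤_ (sym (ℤ.*-identityʳ (+ a))) (sym (ℤ.*-identityʳ (+ b))) (ℤ.+≤+ a≤b))

  ι-cancel-≤ : ∀ {a b} → ι a ≤ ι b → a ℕ.≤ b
  ι-cancel-≤ {a} {b} ιa≤ιb rewrite ι-normal a | ι-normal b with ιa≤ιb
  ... | *≤* p with subst₂ ℤ._≤_ (ℤ.*-identityʳ (+ a)) (ℤ.*-identityʳ (+ b)) p
  ...   | ℤ.+≤+ a≤b = a≤b

module RationalFacts where

  open import Data.Rational
  open import Data.Rational.Properties
  open import Algebra.Properties.AbelianGroup +-0-abelianGroup
    using (⁻¹-involutive; ∙-cancelˡ)
  open import Data.List using (List; []; _∷_)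
  open import Data.List.Relation.Unary.All as All using (All; []; _∷_)
  open import Data.Product using (∃; _×_; _,_)
  open import Data.Sum using (inj₁; inj₂)
  open import Function using (_∘_)
  open import Relation.Nullary using (yes; no; contradiction)
  open import Relation.Binary.Definitions using (tri<; tri≈; tri>)
  open import Relation.Binary.PropositionalEquality

  +-cancelˡ-≡ : ∀ a {b c} → a + b ≡ a + c → b ≡ c
  +-cancelˡ-≡ a {b} {c} = ∙-cancelˡ a b c

  squeeze : ∀ {a b p q} → a ≤ p → b ≤ q → p + q ≤ a + b → a ≡ p
  squeeze a≤p b≤q p+q≤a+b =
    ≤-antisym a≤p (≮⇒≥ λ a<p → <-irrefl refl (<-≤-trans (+-mono-<-≤ a<p b≤q) p+q≤a+b))

  0≤difference : ∀ {a v} → v ≤ a → 0ℚ ≤ a - v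
  0≤difference {a} {v} v≤a = subst (_≤ a - v) (+-inverseʳ v) (+-monoˡ-≤ (- v) v≤a)

  ≤∧≢⇒< : ∀ {a b} → a ≤ b → a ≢ b → a < b
  ≤∧≢⇒< {a} {b} a≤b a≢b with <-cmp a b
  ... | tri< a<b _ _ = a<b
  ... | tri≈ _ a≡b _ = contradiction a≡b a≢b
  ... | tri> _ _ a>b = contradiction (≤-antisym a≤b (<⇒≤ a>b)) a≢b

  0<difference : ∀ {a v} → v < a → 0ℚ < a - v
  0<difference {a} {v} v<a = subst (_< a - v) (+-inverseʳ v) (+-monoˡ-< (- v) v<a)

  add-margin : ∀ {s p ε} → ε ≤ p - s → s + ε ≤ p
  add-margin {s} {p} {ε} ε≤p-s = subst (s + ε ≤_) s+[p-s]≡p (+-monoʳ-≤ s ε≤p-s)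
    where
    s+[p-s]≡p : s + (p - s) ≡ p
    s+[p-s]≡p = begin
      s + (p - s)   ≡⟨ cong (s +_) (+-comm p (- s)) ⟩
      s + (- s + p) ≡⟨ sym (+-assoc s (- s) p) ⟩
      (s - s) + p   ≡⟨ cong (_+ p) (+-inverseʳ s) ⟩
      0ℚ + p        ≡⟨ +-identityˡ p ⟩
      p             ∎
      where open ≡-Reasoning

  positiveLowerBound : (qs : List ℚ) →
    ∃ λ ε → 0ℚ < ε × All (λ q → 0ℚ < q → ε ≤ q) qs
  positiveLowerBound [] = 1ℚ , positive⁻¹ 1ℚ , []
  positiveLowerBound (q ∷ qs) with positiveLowerBound qs | 0ℚ <? q
  ... | ε , 0<ε , below | no 0≮q = ε , 0<ε , (λ 0<q → contradiction 0<q 0≮q) ∷ below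
  ... | ε , 0<ε , below | yes 0<q =
    ε ⊓ q , 0<min , (λ _ → p⊓q≤q ε q) ∷ All.map (λ ε≤ → ≤-trans (p⊓q≤p ε _) ∘ ε≤) below
    where
    0<min : 0ℚ < ε ⊓ q
    0<min with ⊓-sel ε q
    ... | inj₁ eq = subst (0ℚ <_) (sym eq) 0<ε
    ... | inj₂ eq = subst (0ℚ <_) (sym eq) 0<q

  Within : ℚ → ℚ → Set
  Within ε v = v ≤ ε × - v ≤ ε

  within-0 : ∀ {ε} → 0ℚ ≤ ε → Within ε 0ℚ
  within-0 0≤ε = 0≤ε , 0≤ε

  within-ε : ∀ {ε} → 0ℚ ≤ ε → Within ε ε
  within-ε 0≤ε = ≤-refl , ≤-trans (neg-antimono-≤ 0≤ε) 0≤ε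

  within-neg : ∀ {ε v} → Within ε v → Within ε (- v)
  within-neg {v = v} (v≤ε , -v≤ε) = -v≤ε , subst (_≤ _) (sym (⁻¹-involutive v)) v≤ε

  nonneg-shift : ∀ {ε a v} → ε ≤ a → Within ε v → 0ℚ ≤ a + v
  nonneg-shift {ε} {a} {v} ε≤a (_ , -v≤ε) =
    subst (0ℚ ≤_) (cong (a +_) (⁻¹-involutive v)) (0≤difference (≤-trans -v≤ε ε≤a))

module SubsetSums where

  open import Data.Bool using (Bool; true; false; _∧_; _∨_)
  open import Data.Fin using (Fin; zero; suc)
  open import Data.Fin.Subset using (Subset; _∩_; _∪_; ⊥; ⁅_⁆; _∈_; _∉_)
  open import Data.Vec using (Vec; []; _∷_; zipWith; replicate; lookup; _[_]≔_)
  open import Data.Vec.Properties using ([]=⇒lookup; lookup⇒[]=)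
  open import Data.Rational
  open import Data.Rational.Properties
  open import Algebra.Bundles using (CommutativeMonoid)
  open import Algebra.Properties.CommutativeSemigroup
    (CommutativeMonoid.commutativeSemigroup +-0-commutativeMonoid) using (interchange)
  open import Relation.Nullary using (contradiction)
  open import Relation.Binary.PropositionalEquality

  ∈⇒lookup-true : ∀ {n} {j : Fin n} {S} → j ∈ S → lookup S j ≡ true
  ∈⇒lookup-true = []=⇒lookup

  ∉⇒lookup-false : ∀ {n} {j : Fin n} {S} → j ∉ S → lookup S j ≡ false
  ∉⇒lookup-false {j = j} {S} j∉S with lookup S j in eq
  ... | true  = contradiction (lookup⇒[]= j S eq) j∉S
  ... | false = refl

  contribution : Bool → ℚ → ℚ
  contribution true  q = q
  contribution false q = 0ℚ

  contribution-0 : ∀ b → contribution b 0ℚ ≡ 0ℚ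
  contribution-0 true  = refl
  contribution-0 false = refl

  sumOver-∷ : ∀ {n} b (S : Subset n) q xs →
    sumOver (b ∷ S) (q ∷ xs) ≡ contribution b q + sumOver S xs
  sumOver-∷ true  S q xs = refl
  sumOver-∷ false S q xs = sym (+-identityˡ _)

  sumOver-pointwise : ∀ {n} (A B C D : Subset n) (x : Vec ℚ n) →
    (∀ j → let q = lookup x j in
      contribution (lookup A j) q + contribution (lookup B j) q
        ≡ contribution (lookup C j) q + contribution (lookup D j) q) →
    sumOver A x + sumOver B x ≡ sumOver C x + sumOver D x
  sumOver-pointwise [] [] [] [] [] _ = refl
  sumOver-pointwise (a ∷ A) (b ∷ B) (c ∷ C) (d ∷ D) (q ∷ xs) pointwise = begin
    sumOver (a ∷ A) (q ∷ xs) + sumOver (b ∷ B) (q ∷ xs)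
      ≡⟨ cong₂ _+_ (sumOver-∷ a A q xs) (sumOver-∷ b B q xs) ⟩
    (contribution a q + sumOver A xs) + (contribution b q + sumOver B xs)
      ≡⟨ interchange (contribution a q) (sumOver A xs) (contribution b q) (sumOver B xs) ⟩
    (contribution a q + contribution b q) + (sumOver A xs + sumOver B xs)
      ≡⟨ cong₂ _+_ (pointwise zero) (sumOver-pointwise A B C D xs (λ j → pointwise (suc j))) ⟩
    (contribution c q + contribution d q) + (sumOver C xs + sumOver D xs)
      ≡⟨ interchange (contribution c q) (contribution d q) (sumOver C xs) (sumOver D xs) ⟩
    (contribution c q + sumOver C xs) + (contribution d q + sumOver D xs)
      ≡⟨ sym (cong₂ _+_ (sumOver-∷ c C q xs) (sumOver-∷ d D q xs)) ⟩
    sumOver (c ∷ C) (q ∷ xs) + sumOver (d ∷ D) (q ∷ xs) ∎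
    where open ≡-Reasoning

  sumOver-modular : ∀ {n} (A B : Subset n) (x : Vec ℚ n) →
    sumOver (A ∩ B) x + sumOver (A ∪ B) x ≡ sumOver A x + sumOver B x
  sumOver-modular A B x = sumOver-pointwise (A ∩ B) (A ∪ B) A B x λ j →
    subst₂ (λ a∧b a∨b → contribution a∧b (lookup x j) + contribution a∨b (lookup x j)
                          ≡ contribution (lookup A j) (lookup x j) + contribution (lookup B j) (lookup x j))
      (sym (lookup-zipWith _∧_ j A B)) (sym (lookup-zipWith _∨_ j A B))
      (boolean-modular (lookup A j) (lookup B j) (lookup x j))
    where
    open import Data.Vec.Properties using (lookup-zipWith)
    boolean-modular : ∀ a b q →
      contribution (a ∧ b) q + contribution (a ∨ b) q ≡ contribution a q + contribution b q
    boolean-modular true  true  q = refl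
    boolean-modular true  false q = +-comm 0ℚ q
    boolean-modular false true  q = refl
    boolean-modular false false q = refl

  sumOver-⊥ : ∀ {n} (x : Vec ℚ n) → sumOver ⊥ x ≡ 0ℚ
  sumOver-⊥ []       = refl
  sumOver-⊥ (_ ∷ xs) = sumOver-⊥ xs

  sumOver-0 : ∀ {n} (S : Subset n) → sumOver S (replicate n 0ℚ) ≡ 0ℚ
  sumOver-0 []          = refl
  sumOver-0 (true ∷ S)  = trans (+-identityˡ _) (sumOver-0 S)
  sumOver-0 (false ∷ S) = sumOver-0 S

  sumOver-⁅⁆ : ∀ {n} (j : Fin n) (x : Vec ℚ n) → sumOver ⁅ j ⁆ x ≡ lookup x j
  sumOver-⁅⁆ zero    (q ∷ xs) = trans (cong (q +_) (sumOver-⊥ xs)) (+-identityʳ q)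
  sumOver-⁅⁆ (suc j) (_ ∷ xs) = sumOver-⁅⁆ j xs

  unit : ∀ {n} → Fin n → ℚ → Vec ℚ n
  unit {n} e a = replicate n 0ℚ [ e ]≔ a

  sumOver-unit : ∀ {n} (S : Subset n) (e : Fin n) a →
    sumOver S (unit e a) ≡ contribution (lookup S e) a
  sumOver-unit (true  ∷ S) zero    a = trans (cong (a +_) (sumOver-0 S)) (+-identityʳ a)
  sumOver-unit (false ∷ S) zero    a = sumOver-0 S
  sumOver-unit (true  ∷ S) (suc e) a = trans (+-identityˡ _) (sumOver-unit S e a)
  sumOver-unit (false ∷ S) (suc e) a = sumOver-unit S e a

  sumOver-unit-∈ : ∀ {n} {S : Subset n} {e} a → e ∈ S → sumOver S (unit e a) ≡ a
  sumOver-unit-∈ {S = S} {e} a e∈S =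
    trans (sumOver-unit S e a) (cong (λ b → contribution b a) (∈⇒lookup-true e∈S))

  sumOver-unit-∉ : ∀ {n} {S : Subset n} {e} a → e ∉ S → sumOver S (unit e a) ≡ 0ℚ
  sumOver-unit-∉ {S = S} {e} a e∉S =
    trans (sumOver-unit S e a) (cong (λ b → contribution b a) (∉⇒lookup-false e∉S))

  sumOver-+ : ∀ {n} (S : Subset n) (x y : Vec ℚ n) →
    sumOver S (zipWith _+_ x y) ≡ sumOver S x + sumOver S y
  sumOver-+ []          []       []       = refl
  sumOver-+ (true  ∷ S) (p ∷ xs) (q ∷ ys) =
    trans (cong ((p + q) +_) (sumOver-+ S xs ys)) (interchange p q (sumOver S xs) (sumOver S ys))
  sumOver-+ (false ∷ S) (_ ∷ xs) (_ ∷ ys) = sumOver-+ S xs ys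

  sumOver-- : ∀ {n} (S : Subset n) (x y : Vec ℚ n) →
    sumOver S (zipWith _-_ x y) ≡ sumOver S x - sumOver S y
  sumOver-- []          []       []       = refl
  sumOver-- (true  ∷ S) (p ∷ xs) (q ∷ ys) = begin
    (p - q) + sumOver S (zipWith _-_ xs ys) ≡⟨ cong ((p - q) +_) (sumOver-- S xs ys) ⟩
    (p - q) + (sumOver S xs - sumOver S ys) ≡⟨ interchange p (- q) (sumOver S xs) (- sumOver S ys) ⟩
    (p + sumOver S xs) + (- q - sumOver S ys) ≡⟨ cong ((p + sumOver S xs) +_) (sym (neg-distrib-+ q (sumOver S ys))) ⟩
    (p + sumOver S xs) - (q + sumOver S ys) ∎
    where open ≡-Reasoning
  sumOver-- (false ∷ S) (_ ∷ xs) (_ ∷ ys) = sumOver-- S xs ys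

module SubsetLattice where

  open import Data.Nat using (ℕ; zero; suc)
  open import Data.Bool using (true; false)
  open import Data.Vec using ([]; _∷_)
  open import Data.Fin.Subset using (Subset; _∩_; _∪_; ⊥; _⊆_)
  open import Data.Fin.Subset.Properties using (⊆-trans; p∩q⊆p; p∩q⊆q; p⊆p∪q; q⊆p∪q)
  open import Data.List using (List; []; _∷_; _++_; map; foldr; filter)
  open import Data.List.Membership.Propositional using () renaming (_∈_ to _∈ₗ_)
  open import Data.List.Membership.Propositional.Properties using (∈-map⁺; ∈-++⁺ˡ; ∈-++⁺ʳ; ∈-filter⁺)
  open import Data.List.Relation.Unary.Any using (here; there)
  open import Data.List.Relation.Unary.All using (All; []; _∷_)
  open import Data.List.Relation.Unary.All.Properties using (all-filter)
  open import Level using (0ℓ)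
  open import Relation.Unary using (Pred; Decidable)
  open import Relation.Binary.PropositionalEquality using (refl)

  allSubsets : ∀ n → List (Subset n)
  allSubsets zero    = [] ∷ []
  allSubsets (suc n) = map (true ∷_) (allSubsets n) ++ map (false ∷_) (allSubsets n)

  ∈-allSubsets : ∀ {n} (S : Subset n) → S ∈ₗ allSubsets n
  ∈-allSubsets []          = here refl
  ∈-allSubsets (true  ∷ S) = ∈-++⁺ˡ (∈-map⁺ (true ∷_) (∈-allSubsets S))
  ∈-allSubsets (false ∷ S) = ∈-++⁺ʳ _ (∈-map⁺ (false ∷_) (∈-allSubsets S))

  module _ {n : ℕ} {P : Pred (Subset n) 0ℓ} (P? : Decidable P) where

    least : Subset n → Subset n
    least A₀ = foldr _∩_ A₀ (filter P? (allSubsets n))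

    greatest : Subset n
    greatest = foldr _∪_ ⊥ (filter P? (allSubsets n))

    least-∈ : (∀ {S T} → P S → P T → P (S ∩ T)) → ∀ {A₀} → P A₀ → P (least A₀)
    least-∈ closed {A₀} PA₀ = go (all-filter P? (allSubsets n))
      where
      go : ∀ {Ss} → All P Ss → P (foldr _∩_ A₀ Ss)
      go []         = PA₀
      go (PS ∷ PSs) = closed PS (go PSs)

    least-⊆ : ∀ A₀ {S} → P S → least A₀ ⊆ S
    least-⊆ A₀ {S} PS = go (∈-filter⁺ P? (∈-allSubsets S) PS)
      where
      go : ∀ {Ss} → S ∈ₗ Ss → foldr _∩_ A₀ Ss ⊆ S
      go {T ∷ Ss} (here refl) = p∩q⊆p T _
      go {T ∷ Ss} (there S∈) = ⊆-trans (p∩q⊆q T _) (go S∈)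

    greatest-∈ : (∀ {S T} → P S → P T → P (S ∪ T)) → P ⊥ → P greatest
    greatest-∈ closed P⊥ = go (all-filter P? (allSubsets n))
      where
      go : ∀ {Ss} → All P Ss → P (foldr _∪_ ⊥ Ss)
      go []         = P⊥
      go (PS ∷ PSs) = closed PS (go PSs)

    greatest-⊇ : ∀ {S} → P S → S ⊆ greatest
    greatest-⊇ {S} PS = go (∈-filter⁺ P? (∈-allSubsets S) PS)
      where
      go : ∀ {Ss} → S ∈ₗ Ss → S ⊆ foldr _∪_ ⊥ Ss
      go {T ∷ Ss} (here refl) = p⊆p∪q _
      go {T ∷ Ss} (there S∈) = ⊆-trans (go S∈) (q⊆p∪q T _)

module Vertices {n : ℕ} (ψ : Subset n → ℕ) (rank : IsPolymatroidRank ψ)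
                (x : Vec ℚ n) (vertex : IsVertex ψ x) where

  open NatEmbedding
  open RationalFacts
  open SubsetSums
  open SubsetLattice
  open IsPolymatroidRank rank
  open import Data.Nat as ℕ using (_∸_)
  open import Data.Nat.Properties using (m+[n∸m]≡n)
  open import Data.Bool using (false)
  open import Data.Fin using (Fin) renaming (_≟_ to _≟ᶠ_)
  open import Data.Fin.Subset using (_∩_; _∪_; ⊥; ⁅_⁆; _∈_; _∉_; _⊆_)
  open import Data.Fin.Subset.Properties
    using (_∈?_; anySubset?; ∉⊥; x∈⁅x⁆; x∈⁅y⁆⇒x≡y; x≢y⇒x∉⁅y⁆; x∈p∩q⁺; x∈p∩q⁻; x∈p∪q⁻; p∩q⊆p)
  open import Data.Vec using (lookup; zipWith; replicate)
  open import Data.Vec.Properties using (lookup-replicate)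
  import Data.Vec.Relation.Unary.All.Properties as VecAll
  open import Data.List using (map; allFin; _++_)
  open import Data.List.Membership.Propositional.Properties using (∈-map⁺; ∈-++⁺ˡ; ∈-++⁺ʳ; ∈-allFin)
  import Data.List.Relation.Unary.All as ListAll
  open import Data.Rational
  open import Data.Rational.Properties
  open import Data.Product using (∃; _×_; _,_; proj₁; proj₂)
  open import Data.Sum using (_⊎_; inj₁; inj₂)
  open import Relation.Nullary using (¬_; Dec; yes; no; contradiction)
  open import Relation.Nullary.Decidable using (_×-dec_; _⊎-dec_; ¬?)
  open import Relation.Binary.PropositionalEquality

  below-ψ : ∀ S → sumOver S x ≤ ι (ψ S)
  below-ψ = proj₁ (proj₁ vertex)

  nonneg : ∀ j → 0ℚ ≤ lookup x j
  nonneg = VecAll.lookup⁺ (proj₂ (proj₁ vertex))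

  Tight : Subset n → Set
  Tight S = sumOver S x ≡ ι (ψ S)

  tight? : ∀ S → Dec (Tight S)
  tight? S = sumOver S x ≟ ι (ψ S)

  tight-⊥ : Tight ⊥
  tight-⊥ = trans (sumOver-⊥ x) (cong ι (sym empty))

  -- Submodularity of ψ against modularity of x(·) forces tightness of S ∩ T
  -- and S ∪ T when S and T are tight.
  tight-∩∪ : ∀ {S T} → Tight S → Tight T → Tight (S ∩ T) × Tight (S ∪ T)
  tight-∩∪ {S} {T} tS tT =
    squeeze (below-ψ (S ∩ T)) (below-ψ (S ∪ T)) ψ-below-x ,
    squeeze (below-ψ (S ∪ T)) (below-ψ (S ∩ T))
      (subst₂ _≤_ (+-comm (ι (ψ (S ∩ T))) _) (+-comm (sumOver (S ∩ T) x) _) ψ-below-x)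
    where
    ψ-below-x : ι (ψ (S ∩ T)) + ι (ψ (S ∪ T)) ≤ sumOver (S ∩ T) x + sumOver (S ∪ T) x
    ψ-below-x = begin
      ι (ψ (S ∩ T)) + ι (ψ (S ∪ T))       ≡⟨ sym (ι-homo-+ (ψ (S ∩ T)) (ψ (S ∪ T))) ⟩
      ι (ψ (S ∩ T) ℕ.+ ψ (S ∪ T))          ≤⟨ ι-mono-≤ (submodular S T) ⟩
      ι (ψ S ℕ.+ ψ T)                      ≡⟨ ι-homo-+ (ψ S) (ψ T) ⟩
      ι (ψ S) + ι (ψ T)                    ≡⟨ sym (cong₂ _+_ tS tT) ⟩
      sumOver S x + sumOver T x            ≡⟨ sym (sumOver-modular S T x) ⟩
      sumOver (S ∩ T) x + sumOver (S ∪ T) x ∎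
      where open ≤-Reasoning

  tight-∩ : ∀ {S T} → Tight S → Tight T → Tight (S ∩ T)
  tight-∩ tS tT = proj₁ (tight-∩∪ tS tT)

  tight-∪ : ∀ {S T} → Tight S → Tight T → Tight (S ∪ T)
  tight-∪ tS tT = proj₂ (tight-∩∪ tS tT)

  slackOf : Subset n → ℚ
  slackOf S = ι (ψ S) - sumOver S x

  record Margin : Set where
    field
      ε            : ℚ
      0<ε          : 0ℚ < ε
      within-slack : ∀ S → ¬ Tight S → sumOver S x + ε ≤ ι (ψ S)
      ε≤coord      : ∀ j → lookup x j ≢ 0ℚ → ε ≤ lookup x j

  -- Only the properties of the margin matter, never its value.
  opaque
    margin : Margin
    margin with positiveLowerBound (map slackOf (allSubsets n) ++ map (lookup x) (allFin n))
    ... | ε , 0<ε , below = record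
      { ε            = ε
      ; 0<ε          = 0<ε
      ; within-slack = λ S loose → add-margin
          (ListAll.lookup below (∈-++⁺ˡ (∈-map⁺ slackOf (∈-allSubsets S)))
            (0<difference (≤∧≢⇒< (below-ψ S) loose)))
      ; ε≤coord      = λ j x≢0 →
          ListAll.lookup below (∈-++⁺ʳ _ (∈-map⁺ (lookup x) (∈-allFin j)))
            (≤∧≢⇒< (nonneg j) (x≢0 ∘ sym))
      }
      where open import Function using (_∘_)

  open Margin margin

  shift-inside : (y : Vec ℚ n) (d : Subset n → ℚ) →
    (∀ S → sumOver S y ≡ sumOver S x + d S) →
    (∀ S → Tight S → d S ≡ 0ℚ) →
    (∀ S → Within ε (d S)) →
    (∀ j → lookup x j ≡ 0ℚ → d ⁅ j ⁆ ≡ 0ℚ) →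
    InPolymatroid ψ y
  shift-inside y d y≡x+d tight⇒0 within off-support = sums , VecAll.lookup⁻ coords
    where
    sums : ∀ S → sumOver S y ≤ ι (ψ S)
    sums S with tight? S
    ... | yes tight = subst (_≤ ι (ψ S))
            (sym (trans (y≡x+d S) (trans (cong (sumOver S x +_) (tight⇒0 S tight)) (+-identityʳ _))))
            (below-ψ S)
    ... | no loose = subst (_≤ ι (ψ S)) (sym (y≡x+d S))
            (≤-trans (+-monoʳ-≤ (sumOver S x) (proj₁ (within S))) (within-slack S loose))
    coords : ∀ j → 0ℚ ≤ lookup y j
    coords j = subst (0ℚ ≤_) (sym yⱼ) (shifted (lookup x j ≟ 0ℚ))
      where
      yⱼ : lookup y j ≡ lookup x j + d ⁅ j ⁆
      yⱼ = trans (sym (sumOver-⁅⁆ j y)) (trans (y≡x+d ⁅ j ⁆) (cong (_+ d ⁅ j ⁆) (sumOver-⁅⁆ j x)))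
      shifted : Dec (lookup x j ≡ 0ℚ) → 0ℚ ≤ lookup x j + d ⁅ j ⁆
      shifted (yes x≡0) = subst (0ℚ ≤_)
        (sym (trans (cong (lookup x j +_) (off-support j x≡0)) (+-identityʳ _))) (nonneg j)
      shifted (no x≢0)  = nonneg-shift (ε≤coord j x≢0) (within ⁅ j ⁆)

  rigid : (w : Vec ℚ n) →
    (∀ S → Tight S → sumOver S w ≡ 0ℚ) →
    (∀ S → Within ε (sumOver S w)) →
    (∀ j → lookup x j ≡ 0ℚ → sumOver ⁅ j ⁆ w ≡ 0ℚ) →
    ∀ S → sumOver S w ≡ 0ℚ
  rigid w tight⇒0 within off-support S = trans (cong (sumOver S) w≡0) (sumOver-0 S)
    where
    w≡0 : w ≡ replicate n 0ℚ
    w≡0 = proj₂ vertex w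
      (shift-inside (zipWith _+_ x w) (λ T → sumOver T w) (λ T → sumOver-+ T x w)
         tight⇒0 within off-support)
      (shift-inside (zipWith _-_ x w) (λ T → - sumOver T w) (λ T → sumOver-- T x w)
         (λ T t → cong -_ (tight⇒0 T t)) (λ T → within-neg (within T))
         (λ j x≡0 → cong -_ (off-support j x≡0)))

  0≤ε : 0ℚ ≤ ε
  0≤ε = <⇒≤ 0<ε

  ε-sum-nonzero : ∀ {w : Vec ℚ n} e → sumOver ⁅ e ⁆ w ≡ ε → ¬ (sumOver ⁅ e ⁆ w ≡ 0ℚ)
  ε-sum-nonzero e w⁅e⁆≡ε w⁅e⁆≡0 = <⇒≢ 0<ε (trans (sym w⁅e⁆≡0) w⁅e⁆≡ε)

  off-support-≢ : ∀ {e j} → lookup x e ≢ 0ℚ → lookup x j ≡ 0ℚ → e ∉ ⁅ j ⁆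
  off-support-≢ {e} xₑ≢0 xⱼ≡0 e∈⁅j⁆ = xₑ≢0 (trans (cong (lookup x) (x∈⁅y⁆⇒x≡y _ e∈⁅j⁆)) xⱼ≡0)

  -- Every element of the support of x lies in some tight set; otherwise x
  -- could be moved by ±ε in that coordinate.
  covered : ∀ e → lookup x e ≢ 0ℚ → ∃ λ S → Tight S × e ∈ S
  covered e xₑ≢0 with anySubset? (λ S → tight? S ×-dec e ∈? S)
  ... | yes found = found
  ... | no none = contradiction (rigid w tight⇒0 within off-support ⁅ e ⁆)
                    (ε-sum-nonzero e (sumOver-unit-∈ ε (x∈⁅x⁆ e)))
    where
    w : Vec ℚ n
    w = unit e ε
    tight⇒0 : ∀ S → Tight S → sumOver S w ≡ 0ℚ
    tight⇒0 S tight = sumOver-unit-∉ ε (λ e∈S → none (S , tight , e∈S))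
    within : ∀ S → Within ε (sumOver S w)
    within S with e ∈? S
    ... | yes e∈S = subst (Within ε) (sym (sumOver-unit-∈ ε e∈S)) (within-ε 0≤ε)
    ... | no  e∉S = subst (Within ε) (sym (sumOver-unit-∉ ε e∉S)) (within-0 0≤ε)
    off-support : ∀ j → lookup x j ≡ 0ℚ → sumOver ⁅ j ⁆ w ≡ 0ℚ
    off-support j xⱼ≡0 = sumOver-unit-∉ ε (off-support-≢ xₑ≢0 xⱼ≡0)

  Separates : Subset n → Fin n → Fin n → Set
  Separates S e i = e ∈ S × i ∉ S

  -- Two distinct elements of the support are separated by a tight set;
  -- otherwise x could be moved by ±ε(1ₑ - 1ᵢ).
  separated : ∀ {e i} → lookup x e ≢ 0ℚ → lookup x i ≢ 0ℚ → e ≢ i →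
    ∃ λ S → Tight S × (Separates S e i ⊎ Separates S i e)
  separated {e} {i} xₑ≢0 xᵢ≢0 e≢i
    with anySubset? (λ S → tight? S ×-dec ((e ∈? S ×-dec ¬? (i ∈? S)) ⊎-dec (i ∈? S ×-dec ¬? (e ∈? S))))
  ... | yes found = found
  ... | no none = contradiction (rigid w tight⇒0 within off-support ⁅ e ⁆)
                    (ε-sum-nonzero e (only-e (x∈⁅x⁆ e) (x≢y⇒x∉⁅y⁆ (e≢i ∘ sym))))
    where
    open import Function using (_∘_)
    w : Vec ℚ n
    w = zipWith _-_ (unit e ε) (unit i ε)
    both : ∀ {S} → e ∈ S → i ∈ S → sumOver S w ≡ 0ℚ
    both {S} e∈S i∈S = trans (sumOver-- S (unit e ε) (unit i ε))
      (trans (cong₂ _-_ (sumOver-unit-∈ ε e∈S) (sumOver-unit-∈ ε i∈S)) (+-inverseʳ ε))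
    neither : ∀ {S} → e ∉ S → i ∉ S → sumOver S w ≡ 0ℚ
    neither {S} e∉S i∉S = trans (sumOver-- S (unit e ε) (unit i ε))
      (cong₂ _-_ (sumOver-unit-∉ ε e∉S) (sumOver-unit-∉ ε i∉S))
    only-e : ∀ {S} → e ∈ S → i ∉ S → sumOver S w ≡ ε
    only-e {S} e∈S i∉S = trans (sumOver-- S (unit e ε) (unit i ε))
      (trans (cong₂ _-_ (sumOver-unit-∈ ε e∈S) (sumOver-unit-∉ ε i∉S)) (+-identityʳ ε))
    only-i : ∀ {S} → e ∉ S → i ∈ S → sumOver S w ≡ - ε
    only-i {S} e∉S i∈S = trans (sumOver-- S (unit e ε) (unit i ε))
      (trans (cong₂ _-_ (sumOver-unit-∉ ε e∉S) (sumOver-unit-∈ ε i∈S)) (+-identityˡ (- ε)))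
    tight⇒0 : ∀ S → Tight S → sumOver S w ≡ 0ℚ
    tight⇒0 S tight with e ∈? S | i ∈? S
    ... | yes e∈S | yes i∈S = both e∈S i∈S
    ... | no  e∉S | no  i∉S = neither e∉S i∉S
    ... | yes e∈S | no  i∉S = contradiction (S , tight , inj₁ (e∈S , i∉S)) none
    ... | no  e∉S | yes i∈S = contradiction (S , tight , inj₂ (i∈S , e∉S)) none
    within : ∀ S → Within ε (sumOver S w)
    within S with e ∈? S | i ∈? S
    ... | yes e∈S | yes i∈S = subst (Within ε) (sym (both e∈S i∈S)) (within-0 0≤ε)
    ... | no  e∉S | no  i∉S = subst (Within ε) (sym (neither e∉S i∉S)) (within-0 0≤ε)
    ... | yes e∈S | no  i∉S = subst (Within ε) (sym (only-e e∈S i∉S)) (within-ε 0≤ε)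
    ... | no  e∉S | yes i∈S = subst (Within ε) (sym (only-i e∉S i∈S)) (within-neg (within-ε 0≤ε))
    off-support : ∀ j → lookup x j ≡ 0ℚ → sumOver ⁅ j ⁆ w ≡ 0ℚ
    off-support j xⱼ≡0 = neither (off-support-≢ xₑ≢0 xⱼ≡0) (off-support-≢ xᵢ≢0 xⱼ≡0)

  -- By separation, on the support of x
  -- the set A consists of e together with A ∩ U; since both A and A ∩ U are
  -- tight, x(e) = ψ(A) - ψ(A ∩ U).
  module SupportCoordinate (e : Fin n) (xₑ≢0 : lookup x e ≢ 0ℚ) where

    open import Function using (_∘_)

    ContainsE AvoidsE : Subset n → Set
    ContainsE S = Tight S × e ∈ S
    AvoidsE   S = Tight S × e ∉ S

    containsE? : ∀ S → Dec (ContainsE S)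
    containsE? S = tight? S ×-dec e ∈? S

    avoidsE? : ∀ S → Dec (AvoidsE S)
    avoidsE? S = tight? S ×-dec ¬? (e ∈? S)

    ∉-∪ : ∀ {S T} → e ∉ S → e ∉ T → e ∉ S ∪ T
    ∉-∪ {S} {T} e∉S e∉T e∈S∪T with x∈p∪q⁻ S T e∈S∪T
    ... | inj₁ e∈S = e∉S e∈S
    ... | inj₂ e∈T = e∉T e∈T

    -- A is the least tight set containing e, U the greatest one avoiding e;
    -- only these extremal properties are used.
    opaque
      A : Subset n
      A = least containsE? (proj₁ (covered e xₑ≢0))

      U : Subset n
      U = greatest avoidsE?

      A-contains-e : ContainsE A
      A-contains-e = least-∈ containsE?
        (λ (tS , e∈S) (tT , e∈T) → tight-∩ tS tT , x∈p∩q⁺ (e∈S , e∈T))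
        (proj₂ (covered e xₑ≢0))

      A-least : ∀ {S} → ContainsE S → A ⊆ S
      A-least = least-⊆ containsE? _

      U-avoids-e : AvoidsE U
      U-avoids-e = greatest-∈ avoidsE?
        (λ (tS , e∉S) (tT , e∉T) → tight-∪ tS tT , ∉-∪ e∉S e∉T)
        (tight-⊥ , ∉⊥)

      U-greatest : ∀ {S} → AvoidsE S → S ⊆ U
      U-greatest = greatest-⊇ avoidsE?

    A-tight : Tight A
    A-tight = proj₁ A-contains-e

    e∈A : e ∈ A
    e∈A = proj₂ A-contains-e

    U-tight : Tight U
    U-tight = proj₁ U-avoids-e

    e∉U : e ∉ U
    e∉U = proj₂ U-avoids-e

    A-minus-e⊆U : ∀ {j} → j ∈ A → lookup x j ≢ 0ℚ → j ≢ e → j ∈ U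
    A-minus-e⊆U j∈A xⱼ≢0 j≢e with separated xₑ≢0 xⱼ≢0 (j≢e ∘ sym)
    ... | S , tight , inj₁ (e∈S , j∉S) = contradiction (A-least (tight , e∈S) j∈A) j∉S
    ... | S , tight , inj₂ (j∈S , e∉S) = U-greatest (tight , e∉S) j∈S

    A-agrees : ∀ j → j ≢ e →
      contribution (lookup A j) (lookup x j) ≡ contribution (lookup (A ∩ U) j) (lookup x j)
    A-agrees j j≢e with lookup x j ≟ 0ℚ | j ∈? A
    ... | yes xⱼ≡0 | _ = begin
      contribution (lookup A j) (lookup x j)       ≡⟨ cong (contribution (lookup A j)) xⱼ≡0 ⟩
      contribution (lookup A j) 0ℚ                 ≡⟨ contribution-0 (lookup A j) ⟩
      0ℚ                                           ≡⟨ sym (contribution-0 (lookup (A ∩ U) j)) ⟩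
      contribution (lookup (A ∩ U) j) 0ℚ           ≡⟨ cong (contribution (lookup (A ∩ U) j)) (sym xⱼ≡0) ⟩
      contribution (lookup (A ∩ U) j) (lookup x j) ∎
      where open ≡-Reasoning
    ... | no xⱼ≢0 | yes j∈A = cong (λ b → contribution b (lookup x j))
      (trans (∈⇒lookup-true j∈A) (sym (∈⇒lookup-true (x∈p∩q⁺ (j∈A , A-minus-e⊆U j∈A xⱼ≢0 j≢e)))))
    ... | no _ | no j∉A = cong (λ b → contribution b (lookup x j))
      (trans (∉⇒lookup-false j∉A) (sym (∉⇒lookup-false (j∉A ∘ proj₁ ∘ x∈p∩q⁻ A U))))

    decomposition : sumOver A x ≡ sumOver (A ∩ U) x + lookup x e
    decomposition = begin
      sumOver A x                       ≡⟨ sym (trans (cong (sumOver A x +_) (sumOver-⊥ x)) (+-identityʳ _)) ⟩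
      sumOver A x + sumOver ⊥ x         ≡⟨ sumOver-pointwise A ⊥ (A ∩ U) ⁅ e ⁆ x pointwise ⟩
      sumOver (A ∩ U) x + sumOver ⁅ e ⁆ x ≡⟨ cong (sumOver (A ∩ U) x +_) (sumOver-⁅⁆ e x) ⟩
      sumOver (A ∩ U) x + lookup x e    ∎
      where
      open ≡-Reasoning
      at : ∀ {j} (S : Subset n) {b} → lookup S j ≡ b →
        contribution (lookup S j) (lookup x j) ≡ contribution b (lookup x j)
      at {j} S eq = cong (λ b → contribution b (lookup x j)) eq
      pointwise : ∀ j →
        contribution (lookup A j) (lookup x j) + contribution (lookup ⊥ j) (lookup x j)
          ≡ contribution (lookup (A ∩ U) j) (lookup x j) + contribution (lookup ⁅ e ⁆ j) (lookup x j)
      pointwise j with j ≟ᶠ e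
      ... | yes refl = begin
        contribution (lookup A e) (lookup x e) + contribution (lookup ⊥ e) (lookup x e)
          ≡⟨ cong₂ _+_ (at A (∈⇒lookup-true e∈A)) (at ⊥ (lookup-replicate e false)) ⟩
        lookup x e + 0ℚ
          ≡⟨ +-comm (lookup x e) 0ℚ ⟩
        0ℚ + lookup x e
          ≡⟨ sym (cong₂ _+_ (at (A ∩ U) (∉⇒lookup-false (e∉U ∘ proj₂ ∘ x∈p∩q⁻ A U)))
                            (at ⁅ e ⁆ (∈⇒lookup-true (x∈⁅x⁆ e)))) ⟩
        contribution (lookup (A ∩ U) e) (lookup x e) + contribution (lookup ⁅ e ⁆ e) (lookup x e) ∎
      ... | no j≢e = cong₂ _+_ (A-agrees j j≢e)
        (trans (at ⊥ (lookup-replicate j false)) (sym (at ⁅ e ⁆ (∉⇒lookup-false (x≢y⇒x∉⁅y⁆ j≢e)))))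

    integral : ∃ λ k → lookup x e ≡ ι k
    integral = k , +-cancelˡ-≡ (ι (ψ (A ∩ U))) (begin
      ι (ψ (A ∩ U)) + lookup x e     ≡⟨ cong (_+ lookup x e) (sym (tight-∩ A-tight U-tight)) ⟩
      sumOver (A ∩ U) x + lookup x e ≡⟨ sym decomposition ⟩
      sumOver A x                    ≡⟨ A-tight ⟩
      ι (ψ A)                        ≡⟨ cong ι (sym (m+[n∸m]≡n (monotone _ _ (p∩q⊆p A U)))) ⟩
      ι (ψ (A ∩ U) ℕ.+ k)            ≡⟨ ι-homo-+ (ψ (A ∩ U)) k ⟩
      ι (ψ (A ∩ U)) + ι k            ∎)
      where
      open ≡-Reasoning
      k : ℕ
      k = ψ A ∸ ψ (A ∩ U)

  coordinate-integral : ∀ e → ∃ λ k → lookup x e ≡ ι k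
  coordinate-integral e with lookup x e ≟ 0ℚ
  ... | yes xₑ≡0 = 0 , xₑ≡0
  ... | no  xₑ≢0 = SupportCoordinate.integral e xₑ≢0

-- Each non-zero such vector arises from one
-- of sum ≤ r - 1 by incrementing one of its n coordinates, which gives a list
-- of them (with repetitions) of length at most 1 + n (n + 1)ʳ⁻¹ ≤ (n + 1)ʳ.
module BoundedVectors where

  open import Data.Nat
  open import Data.Nat.Properties
  open import Data.Fin using (Fin; zero; suc)
  open import Data.Vec as Vec using (Vec; []; _∷_; replicate; _[_]%=_)
  open import Data.List using (List; []; _∷_; _++_; length; map; allFin; cartesianProductWith)
  open import Data.List.Properties using (length-++; length-map; length-tabulate)
  open import Data.List.Membership.Propositional using (_∈_)
  open import Data.List.Membership.Propositional.Properties
    using (∈-allFin; ∈-cartesianProductWith⁺)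
  open import Data.List.Relation.Unary.Any using (here; there)
  open import Data.Product using (∃₂; _×_; _,_)
  open import Data.Sum using (_⊎_; inj₁; inj₂)
  open import Relation.Nullary using (contradiction)
  open import Relation.Binary.PropositionalEquality

  increment : ∀ {n} → Fin n → Vec ℕ n → Vec ℕ n
  increment i v = v [ i ]%= suc

  decrement : ∀ {n} (v : Vec ℕ n) → v ≡ replicate n 0 ⊎
    ∃₂ λ i w → v ≡ increment i w × suc (Vec.sum w) ≡ Vec.sum v
  decrement [] = inj₁ refl
  decrement (suc k ∷ v) = inj₂ (zero , k ∷ v , refl , refl)
  decrement (zero ∷ v) with decrement v
  ... | inj₁ v≡0 = inj₁ (cong (0 ∷_) v≡0)
  ... | inj₂ (i , w , v≡w⁺ , sum-w<sum-v) = inj₂ (suc i , 0 ∷ w , cong (0 ∷_) v≡w⁺ , sum-w<sum-v)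

  boundedVectors : ∀ n → ℕ → List (Vec ℕ n)
  boundedVectors n zero    = replicate n 0 ∷ []
  boundedVectors n (suc r) = replicate n 0 ∷ cartesianProductWith increment (allFin n) (boundedVectors n r)

  boundedVectors-complete : ∀ {n} r (v : Vec ℕ n) → Vec.sum v ≤ r → v ∈ boundedVectors n r
  boundedVectors-complete r v sum≤r with decrement v
  boundedVectors-complete zero    v sum≤r | inj₁ v≡0 = here v≡0
  boundedVectors-complete (suc r) v sum≤r | inj₁ v≡0 = here v≡0
  boundedVectors-complete zero    v sum≤0 | inj₂ (_ , _ , _ , sum-w<sum-v) =
    contradiction (≤-trans (≤-reflexive sum-w<sum-v) sum≤0) λ ()
  boundedVectors-complete (suc r) v sum≤r | inj₂ (i , w , refl , sum-w<sum-v) =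
    there (∈-cartesianProductWith⁺ increment (∈-allFin i)
      (boundedVectors-complete r w (≤-pred (≤-trans (≤-reflexive sum-w<sum-v) sum≤r))))

  length-cartesianProductWith : ∀ {A B C : Set} (f : A → B → C) xs ys →
    length (cartesianProductWith f xs ys) ≡ length xs * length ys
  length-cartesianProductWith f []       ys = refl
  length-cartesianProductWith f (x ∷ xs) ys = begin
    length (map (f x) ys ++ cartesianProductWith f xs ys)          ≡⟨ length-++ (map (f x) ys) ⟩
    length (map (f x) ys) + length (cartesianProductWith f xs ys)  ≡⟨ cong₂ _+_ (length-map (f x) ys)
                                                                         (length-cartesianProductWith f xs ys) ⟩
    length ys + length xs * length ys                              ∎
    where open ≡-Reasoning

  length-boundedVectors : ∀ n r → length (boundedVectors n r) ≤ suc n ^ r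
  length-boundedVectors n zero    = ≤-refl
  length-boundedVectors n (suc r) = begin
    suc (length (cartesianProductWith increment (allFin n) (boundedVectors n r)))
      ≡⟨ cong suc (trans (length-cartesianProductWith increment (allFin n) (boundedVectors n r))
                         (cong (_* length (boundedVectors n r)) (length-tabulate {n = n} (λ i → i)))) ⟩
    suc (n * length (boundedVectors n r))
      ≤⟨ +-mono-≤ (m^n>0 (suc n) r) (*-monoʳ-≤ n (length-boundedVectors n r)) ⟩
    suc n ^ r + n * suc n ^ r ∎
    where open ≤-Reasoning

module Counting where

  open import Data.Nat using (_≤_)
  open import Data.Fin using (Fin; zero; suc)
  open import Data.Fin.Properties using (injective⇒≤)
  open import Data.List using (List; length; lookup)
  open import Data.List.Membership.Propositional using (_∈_)
  open import Data.List.Membership.Propositional.Properties using (∈-lookup)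
  open import Data.List.Relation.Unary.Any using (index)
  open import Data.List.Relation.Unary.Any.Properties using (lookup-index)
  open import Data.List.Relation.Unary.All as All using (All)
  open import Data.List.Relation.Unary.AllPairs using (_∷_)
  open import Data.List.Relation.Unary.Unique.Propositional using (Unique)
  open import Relation.Nullary using (contradiction)
  open import Relation.Binary.PropositionalEquality

  unique-lookup-injective : ∀ {A : Set} {xs : List A} → Unique xs →
    ∀ i j → lookup xs i ≡ lookup xs j → i ≡ j
  unique-lookup-injective (_ ∷ _)        zero    zero    _  = refl
  unique-lookup-injective (x∉xs ∷ _)    zero    (suc j) eq = contradiction eq (All.lookup x∉xs (∈-lookup j))
  unique-lookup-injective (x∉xs ∷ _)    (suc i) zero    eq = contradiction (sym eq) (All.lookup x∉xs (∈-lookup i))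
  unique-lookup-injective (_ ∷ unique) (suc i) (suc j) eq = cong suc (unique-lookup-injective unique i j eq)

  unique-length-≤ : ∀ {A : Set} {xs ys : List A} → Unique xs → All (_∈ ys) xs → length xs ≤ length ys
  unique-length-≤ {xs = xs} {ys} unique xs⊆ys = injective⇒≤ {f = position} position-injective
    where
    position : Fin (length xs) → Fin (length ys)
    position i = index (All.lookup xs⊆ys (∈-lookup i))
    position-injective : ∀ {i j} → position i ≡ position j → i ≡ j
    position-injective {i} {j} eq = unique-lookup-injective unique i j (begin
      lookup xs i           ≡⟨ lookup-index (All.lookup xs⊆ys (∈-lookup i)) ⟩
      lookup ys (position i) ≡⟨ cong (lookup ys) eq ⟩
      lookup ys (position j) ≡⟨ sym (lookup-index (All.lookup xs⊆ys (∈-lookup j))) ⟩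
      lookup xs j           ∎)
      where open ≡-Reasoning

module VertexEnumeration where

  open NatEmbedding
  open BoundedVectors
  open import Data.Nat using (_≤_)
  open import Data.Fin.Subset using (⊤)
  open import Data.Vec as Vec using ([]; _∷_; lookup; tabulate)
  open import Data.Vec.Properties using (tabulate∘lookup; tabulate-cong; tabulate-∘)
  open import Data.List using (map)
  open import Data.List.Membership.Propositional using (_∈_)
  open import Data.List.Membership.Propositional.Properties using (∈-map⁺)
  open import Data.Rational using () renaming (_≤_ to _≤ℚ_; _+_ to _+ℚ_)
  open import Data.Rational.Properties using () renaming (≤-trans to ≤ℚ-trans)
  open import Data.Product using (proj₁; proj₂)
  open import Relation.Binary.PropositionalEquality

  sumOver-⊤-ι : ∀ {n} (v : Vec ℕ n) → sumOver ⊤ (Vec.map ι v) ≡ ι (Vec.sum v)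
  sumOver-⊤-ι []      = refl
  sumOver-⊤-ι (k ∷ v) = trans (cong (ι k +ℚ_) (sumOver-⊤-ι v)) (sym (ι-homo-+ k (Vec.sum v)))

  vertex-listed : ∀ r {n} (ψ : Subset n → ℕ) → IsPolymatroidRank ψ → (∀ A → ψ A ≤ r) →
    ∀ x → IsVertex ψ x → x ∈ map (Vec.map ι) (boundedVectors n r)
  vertex-listed r {n} ψ rank ψ≤r x vertex =
    subst (_∈ map (Vec.map ι) (boundedVectors n r)) (sym x≡ιv)
      (∈-map⁺ (Vec.map ι) (boundedVectors-complete r v sum-v≤r))
    where
    open Vertices ψ rank x vertex using (coordinate-integral; below-ψ)
    v : Vec ℕ n
    v = tabulate (λ e → proj₁ (coordinate-integral e))
    x≡ιv : x ≡ Vec.map ι v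
    x≡ιv = trans (sym (tabulate∘lookup x))
      (trans (tabulate-cong (λ e → proj₂ (coordinate-integral e)))
             (tabulate-∘ ι (λ e → proj₁ (coordinate-integral e))))
    sum-v≤r : Vec.sum v ≤ r
    sum-v≤r = ι-cancel-≤ (≤ℚ-trans
      (subst (_≤ℚ ι (ψ ⊤)) (trans (cong (sumOver ⊤) x≡ιv) (sumOver-⊤-ι v)) (below-ψ ⊤))
      (ι-mono-≤ (ψ≤r ⊤)))

open import Data.Nat using (suc; _≤_; _*_; _^_)
open import Data.Nat.Properties using (*-identityˡ; module ≤-Reasoning)
open import Data.List using (List; length; map)
open import Data.List.Properties using (length-map)
open import Data.List.Relation.Unary.All using (All)
import Data.List.Relation.Unary.All as All
open import Data.List.Relation.Unary.Unique.Propositional using (Unique)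
open import Data.Product using (∃; _,_)
import Data.Vec as Vec
open import Relation.Binary.PropositionalEquality using (sym)
open NatEmbedding using (ι)
open BoundedVectors using (boundedVectors; length-boundedVectors)
open Counting using (unique-length-≤)
open VertexEnumeration using (vertex-listed)

-- Distinct vertices are distinct entries of the list ι(boundedVectors n r),
-- whose length is at most (n + 1)ʳ; so C = 1 works.
mainTheorem6 : (r : ℕ) → ∃ λ (C : ℕ) →
    (n : ℕ) (ψ : Subset n → ℕ) → IsPolymatroidRank ψ → (∀ A → ψ A ≤ r) →
    (vs : List (Vec ℚ n)) → Unique vs → All (IsVertex ψ) vs →
    length vs ≤ C * (suc n) ^ r
mainTheorem6 r = 1 , λ n ψ rank ψ≤r vs unique vertices → begin
    length vs
      ≤⟨ unique-length-≤ unique (All.map (vertex-listed r ψ rank ψ≤r _) vertices) ⟩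
    length (map (Vec.map ι) (boundedVectors n r))
      ≡⟨ length-map (Vec.map ι) (boundedVectors n r) ⟩
    length (boundedVectors n r)
      ≤⟨ length-boundedVectors n r ⟩
    suc n ^ r
      ≡⟨ sym (*-identityˡ _) ⟩
    1 * suc n ^ r ∎
  where open ≤-Reasoning
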